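{- Let $G$ be an ordered graph and $k,\ell\in\mathbb{N}$. If the irreducible block decomposition of $G$ has at least $k$ blocks of order at least $\ell$, then $S_n(G)\geqslant F_{n,\ell}$ for each $n\leqslant k$.
   Context: An ordered graph of order $n$ is a graph on vertex set $[n]$ with the natural order. For an ordered graph $G$, a pair of vertices $u<v$ separates the edges of $G$ if every edge $ij$ with $i<j$ satisfies $j\leqslant u$ or $v\leqslant i$; $G$ is irreducible if no pair of vertices separates its edges. Every ordered graph has a unique irreducible block decomposition: a partition of $V(G)$ into intervals of consecutive vertices such that each interval induces an irreducible ordered graph and there are no edges between different intervals. $S_n(G)$ denotes the number of distinct (pairwise non-isomorphic under order-preserving isomorphism) induced ordered subgraphs of $G$ of order $n$. Generalized Fibonacci numbers: $F_{n,\ell}=0$ for $n<0$, $F_{0,\ell}=1$, $F_{n,\ell}=F_{n-1,\ell}+\cdots+F_{n-\ell,\ell}$ for $n\ge1$. -}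

module Defs where

open import Data.Nat using (ℕ; zero; suc; _+_; _∸_; _≤_; _<_; _≤?_; _<ᵇ_)
open import Data.Nat.Properties using (+-monoʳ-<)
open import Data.Fin as Fin using (Fin; toℕ; fromℕ<)
open import Data.Fin.Properties using (toℕ<n)
open import Data.Bool using (Bool; true; false; if_then_else_)
open import Data.List as List using (List; []; _∷_; length; filter; take)
open import Data.Nat.ListAction using (sum)
open import Data.Vec as Vec using (Vec; _∷_; [])
open import Data.Product using (Σ; _×_; _,_)
open import Relation.Binary.PropositionalEquality using (_≡_)
open import Relation.Nullary using (¬_)
open import Function.Bundles using (Bijection)

record OGraph (N : ℕ) : Set where
  field
    adj    : Fin N → Fin N → Bool
    sym    : ∀ i j → adj i j ≡ adj j i
    irrefl : ∀ i → adj i i ≡ false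
open OGraph public

Edge : ∀ {N} → OGraph N → Fin N → Fin N → Set
Edge G i j = adj G i j ≡ true

-- order-preserving injections Fin n → Fin N (= n-element vertex subsets)
record Embedding (n N : ℕ) : Set where
  field
    emb  : Fin n → Fin N
    mono : ∀ {i j} → i Fin.< j → emb i Fin.< emb j
open Embedding public

induced : ∀ {n N} → OGraph N → Embedding n N → OGraph n
induced G f = record
  { adj    = λ i j → adj G (emb f i) (emb f j)
  ; sym    = λ i j → sym G (emb f i) (emb f j)
  ; irrefl = λ i → irrefl G (emb f i) }

record OIso {n : ℕ} (G H : OGraph n) : Set where
  field
    φ       : Bijection (Relation.Binary.PropositionalEquality.setoid (Fin n))
                        (Relation.Binary.PropositionalEquality.setoid (Fin n))
    orderP  : ∀ {i j} → i Fin.< j → Bijection.to φ i Fin.< Bijection.to φ j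
    adjP    : ∀ i j → adj G i j ≡ adj H (Bijection.to φ i) (Bijection.to φ j)

-- "S_n(G) ≥ m": there are m induced ordered subgraphs of G of order n that are
-- pairwise non-isomorphic (under order-preserving isomorphism).
AtLeastSubgraphs : ∀ {N} → (n : ℕ) → OGraph N → (m : ℕ) → Set
AtLeastSubgraphs {N} n G m =
  Σ (Fin m → Embedding n N) λ e →
    ∀ a b → OIso (induced G (e a)) (induced G (e b)) → a ≡ b

Separates : ∀ {N} → OGraph N → Fin N → Fin N → Set
Separates G u v = u Fin.< v × (∀ i j → i Fin.< j → Edge G i j → (j Fin.≤ u) Data.Sum.⊎ (v Fin.≤ i))
  where import Data.Sum

Irreducible : ∀ {N} → OGraph N → Set
Irreducible G = ∀ u v → ¬ Separates G u v

interval : ∀ {N} (a s : ℕ) → a + s ≤ N → Embedding s N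
interval a s p = record
  { emb  = λ i → fromℕ< (Data.Nat.Properties.≤-trans (+-monoʳ-< a (toℕ<n i)) p)
  ; mono = λ {i} {j} i<j → Relation.Binary.PropositionalEquality.subst₂ _<_
      (Relation.Binary.PropositionalEquality.sym (toℕ-fromℕ< _))
      (Relation.Binary.PropositionalEquality.sym (toℕ-fromℕ< _))
      (+-monoʳ-< a i<j) }
  where import Data.Nat.Properties
        open import Data.Fin.Properties using (toℕ-fromℕ<)
        import Relation.Binary.PropositionalEquality

-- A decomposition of [N] into consecutive intervals is given by the list of
-- interval sizes s₁ ∷ s₂ ∷ …; blockIndex ss x is the index of the interval
-- containing vertex x.
blockIndex : List ℕ → ℕ → ℕ
blockIndex [] x = 0
blockIndex (s ∷ ss) x = if x <ᵇ s then 0 else suc (blockIndex ss (x ∸ s))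

BlocksFrom : ∀ {N} → OGraph N → ℕ → List ℕ → Set
BlocksFrom {N} G a [] = a ≡ N
BlocksFrom {N} G a (s ∷ ss) =
  1 ≤ s × Σ (a + s ≤ N) (λ p → Irreducible (induced G (interval a s p)))
        × BlocksFrom G (a + s) ss

IsBlockDecomposition : ∀ {N} → OGraph N → List ℕ → Set
IsBlockDecomposition G ss =
  BlocksFrom G 0 ss ×
  (∀ i j → Edge G i j → blockIndex ss (toℕ i) ≡ blockIndex ss (toℕ j))

bigBlocks : ℕ → List ℕ → ℕ
bigBlocks ℓ ss = length (filter (ℓ ≤?_) ss)

-- generalized Fibonacci numbers: fibs ℓ n = [F_{n,ℓ}, F_{n-1,ℓ}, …, F_{0,ℓ}]
fibs : ℕ → (n : ℕ) → Vec ℕ (suc n)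
fibs ℓ zero = 1 ∷ []
fibs ℓ (suc n) = sum (take ℓ (Vec.toList (fibs ℓ n))) ∷ fibs ℓ n

F : ℕ → ℕ → ℕ
F n ℓ = Vec.head (fibs ℓ n)

-- Compositions of n with parts in {1, …, ℓ} are counted by F n ℓ. Given one, (c₁, …, c_m) with
-- m ≤ n ≤ k, choose in the i-th block of order ≥ ℓ an irreducible induced subgraph of order cᵢ
-- (an irreducible ordered graph has irreducible induced subgraphs of every smaller order, grown
-- one vertex at a time). Distinct blocks are not adjacent, so the union of these subgraphs is an
-- induced subgraph with block decomposition (c₁, …, c_m). An order-preserving isomorphism between
-- ordered graphs of the same order is the identity, so distinct compositions give non-isomorphic
-- subgraphs.
module Submission where

open import Defs hiding (sym; mono)
open import Data.Bool using (Bool; true; false; if_then_else_; T)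
import Data.Bool.Properties as Bool
open import Data.Empty using (⊥-elim)
open import Data.Fin as Fin using (Fin; toℕ; fromℕ<; inject₁; splitAt; join)
open import Data.Fin.Properties using (any?; join-splitAt; toℕ-inject₁; toℕ-fromℕ<; toℕ-injective; toℕ<n)
open import Data.List as List using (List; []; _∷_; take)
open import Data.List.Properties using (∷-injectiveˡ; ∷-injectiveʳ; filter-accept; filter-reject)
open import Data.List.Relation.Unary.All using (All; []; _∷_)
open import Data.Nat
open import Data.Nat.ListAction using (sum)
open import Data.Nat.Properties
open import Data.Product using (Σ; ∃₂; _×_; _,_; proj₁; proj₂)
open import Data.Sum using (_⊎_; inj₁; inj₂; [_,_]′)
open import Data.Unit using (tt)
open import Data.Vec as Vec using ()
open import Function using (_∘_; id; const)
open import Function.Bundles using (Bijection)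
open import Relation.Binary.Core using (_Preserves_⟶_)
open import Relation.Binary.Definitions using (tri<; tri≈; tri>)
open import Relation.Binary.PropositionalEquality
open import Relation.Nullary using (¬_; contradiction; yes; no)
open import Relation.Nullary.Decidable using (_×-dec_)

-- Order-preserving isomorphisms

strictMono⇒toℕ≤ : ∀ {m n} (f : Fin m → Fin n) → f Preserves Fin._<_ ⟶ Fin._<_ → ∀ i → toℕ i ≤ toℕ (f i)
strictMono⇒toℕ≤ f mono Fin.zero    = z≤n
strictMono⇒toℕ≤ f mono (Fin.suc i) = begin
  suc (toℕ i)                  ≤⟨ s≤s (strictMono⇒toℕ≤ (f ∘ inject₁) (mono ∘ inject₁-mono) i) ⟩
  suc (toℕ (f (inject₁ i)))    ≤⟨ mono (≤-reflexive (cong suc (toℕ-inject₁ i))) ⟩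
  toℕ (f (Fin.suc i))          ∎
  where
    open ≤-Reasoning
    inject₁-mono : ∀ {m} {i j : Fin m} → i Fin.< j → inject₁ i Fin.< inject₁ j
    inject₁-mono {i = i} {j} = subst₂ _<_ (sym (toℕ-inject₁ i)) (sym (toℕ-inject₁ j))

-- both the map and its inverse move every point upwards
strictMonoBijection⇒≡id : ∀ {n} (φ : Bijection (setoid (Fin n)) (setoid (Fin n))) →
                          Bijection.to φ Preserves Fin._<_ ⟶ Fin._<_ → ∀ i → Bijection.to φ i ≡ i
strictMonoBijection⇒≡id {n} φ mono i = toℕ-injective (≤-antisym fi≤i (strictMono⇒toℕ≤ f mono i))
  where
    open Bijection φ using (strictlySurjective; injective) renaming (to to f)
    g : Fin n → Fin n
    g = proj₁ ∘ strictlySurjective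
    f∘g : ∀ j → f (g j) ≡ j
    f∘g = proj₂ ∘ strictlySurjective
    g-mono : g Preserves Fin._<_ ⟶ Fin._<_
    g-mono {j} {k} j<k with Data.Fin.Properties.<-cmp (g j) (g k)
    ... | tri< gj<gk _ _ = gj<gk
    ... | tri≈ _ gj≡gk _ = contradiction (trans (sym (f∘g j)) (trans (cong f gj≡gk) (f∘g k))) (<⇒≢ j<k ∘ cong toℕ)
    ... | tri> _ _ gk<gj = contradiction (subst₂ Fin._<_ (f∘g k) (f∘g j) (mono gk<gj)) (<⇒≯ j<k)
    fi≤i : toℕ (f i) ≤ toℕ i
    fi≤i = subst (λ x → toℕ (f i) ≤ toℕ x) (injective (f∘g (f i))) (strictMono⇒toℕ≤ g g-mono (f i))

orderIso⇒adj≡ : ∀ {n} {H H′ : OGraph n} → OIso H H′ → ∀ i j → adj H i j ≡ adj H′ i j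
orderIso⇒adj≡ {H′ = H′} iso i j = trans (adjP i j) (cong₂ (adj H′) (≡id i) (≡id j))
  where
    open OIso iso
    ≡id = strictMonoBijection⇒≡id φ orderP

-- Increasing sequences and insertion

StrictMonoOn : ℕ → (ℕ → ℕ) → Set
StrictMonoOn c f = ∀ {p q} → p < q → q < c → f p < f q

module _ {c : ℕ} {f : ℕ → ℕ} (mono : StrictMonoOn c f) where

  strictMonoOn⇒monoOn : ∀ {p q} → p ≤ q → q < c → f p ≤ f q
  strictMonoOn⇒monoOn p≤q q<c with m≤n⇒m<n∨m≡n p≤q
  ... | inj₁ p<q  = <⇒≤ (mono p<q q<c)
  ... | inj₂ refl = ≤-refl

  strictMonoOn-stretch : ∀ {p} → p < c → f 0 + p ≤ f p
  strictMonoOn-stretch {zero}  _     = ≤-reflexive (+-identityʳ (f 0))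
  strictMonoOn-stretch {suc p} p+1<c = begin
    f 0 + suc p ≡⟨ +-suc (f 0) p ⟩
    suc (f 0 + p) ≤⟨ s≤s (strictMonoOn-stretch (<-trans (n<1+n p) p+1<c)) ⟩
    suc (f p)     ≤⟨ mono (n<1+n p) p+1<c ⟩
    f (suc p)     ∎
    where open ≤-Reasoning

-- Opaque, so that terms built from piecewise (insert, embed) are rigid for unification;
-- they are used only through piecewise-< and piecewise-≥.
opaque
  piecewise : ℕ → (ℕ → ℕ) → (ℕ → ℕ) → ℕ → ℕ
  piecewise c f g x = if x <ᵇ c then f x else g x

  piecewise-< : ∀ {c} (f g : ℕ → ℕ) {x} → x < c → piecewise c f g x ≡ f x
  piecewise-< {c} f g {x} x<c with x <ᵇ c | <⇒<ᵇ x<c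
  ... | true | _ = refl

  piecewise-≥ : ∀ {c} (f g : ℕ → ℕ) {x} → c ≤ x → piecewise c f g x ≡ g x
  piecewise-≥ {c} f g {x} c≤x with x <ᵇ c in eq
  ... | false = refl
  ... | true  = contradiction (<ᵇ⇒< x c (subst T (sym eq) tt)) (≤⇒≯ c≤x)

data Position (c : ℕ) : ℕ → Set where
  inHead : ∀ {x} → x < c → Position c x
  inTail : ∀ y → Position c (c + y)

position : ∀ c x → Position c x
position c x with x <? c
... | yes x<c = inHead x<c
... | no  x≮c = subst (Position c) (m+[n∸m]≡n (≮⇒≥ x≮c)) (inTail (x ∸ c))

insert : ℕ → ℕ → (ℕ → ℕ) → ℕ → ℕ
insert r v π = piecewise r π (piecewise (suc r) (const v) (π ∘ pred))

shift : ℕ → ℕ → ℕ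
shift r = piecewise r id suc

shift-< : ∀ {r x} → x < r → shift r x ≡ x
shift-< = piecewise-< id suc

shift-≥ : ∀ {r x} → r ≤ x → shift r x ≡ suc x
shift-≥ = piecewise-≥ id suc

module _ {r v : ℕ} {π : ℕ → ℕ} where
  private
    tail = piecewise (suc r) (const v) (π ∘ pred)

  insert-< : ∀ {x} → x < r → insert r v π x ≡ π x
  insert-< = piecewise-< π tail

  insert-≡ : insert r v π r ≡ v
  insert-≡ = trans (piecewise-≥ π tail {r} ≤-refl) (piecewise-< (const v) (π ∘ pred) (n<1+n r))

  insert-> : ∀ {x} → r ≤ x → insert r v π (suc x) ≡ π x
  insert-> r≤x = trans (piecewise-≥ π tail (m≤n⇒m≤1+n r≤x)) (piecewise-≥ (const v) (π ∘ pred) (s≤s r≤x))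

  insert-shift : ∀ x → insert r v π (shift r x) ≡ π x
  insert-shift x with <-cmp x r
  ... | tri< x<r _ _ = trans (cong (insert r v π) (shift-< x<r)) (insert-< x<r)
  ... | tri≈ _ x≡r _ = trans (cong (insert r v π) (shift-≥ r≤x)) (insert-> r≤x)
    where r≤x = ≤-reflexive (sym x≡r)
  ... | tri> _ _ r<x = trans (cong (insert r v π) (shift-≥ (<⇒≤ r<x))) (insert-> (<⇒≤ r<x))

shift≤suc : ∀ r x → shift r x ≤ suc x
shift≤suc r x with x <? r
... | yes x<r = ≤-trans (≤-reflexive (shift-< x<r)) (n≤1+n x)
... | no  x≮r = ≤-reflexive (shift-≥ (≮⇒≥ x≮r))

≤shift : ∀ r x → x ≤ shift r x
≤shift r x with x <? r
... | yes x<r = ≤-reflexive (sym (shift-< x<r))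
... | no  x≮r = ≤-trans (n≤1+n x) (≤-reflexive (sym (shift-≥ (≮⇒≥ x≮r))))

module _ {c r v : ℕ} {π : ℕ → ℕ} (r≤c : r ≤ c) where

  insert-strictMono : StrictMonoOn c π → (0 < r → π (pred r) < v) → (r < c → v < π r) →
                      StrictMonoOn (suc c) (insert r v π)
  insert-strictMono mono before after {p} {q} p<q q<c+1 with <-cmp q r
  ... | tri< q<r _ _ = begin-strict
    insert r v π p ≡⟨ insert-< (<-trans p<q q<r) ⟩
    π p            <⟨ mono p<q (<-≤-trans q<r r≤c) ⟩
    π q            ≡⟨ insert-< q<r ⟨
    insert r v π q ∎
    where open ≤-Reasoning
  ... | tri≈ _ refl _ = begin-strict
    insert r v π p ≡⟨ insert-< p<q ⟩
    π p            ≤⟨ strictMonoOn⇒monoOn mono (<⇒≤pred p<q) (<-≤-trans (pred-< p<q) r≤c) ⟩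
    π (pred r)     <⟨ before (≤-<-trans z≤n p<q) ⟩
    v              ≡⟨ insert-≡ ⟨
    insert r v π r ∎
    where open ≤-Reasoning
          pred-< : ∀ {m n} → m < n → pred n < n
          pred-< (s≤s _) = ≤-refl
  insert-strictMono mono before after {p} {suc q} p<q q<c+1 | tri> _ _ r≤q with <-cmp p r
  ... | tri< p<r _ _ = begin-strict
    insert r v π p       ≡⟨ insert-< p<r ⟩
    π p                  <⟨ mono (<-≤-trans p<r (≤-pred r≤q)) (≤-pred q<c+1) ⟩
    π q                  ≡⟨ insert-> (≤-pred r≤q) ⟨
    insert r v π (suc q) ∎
    where open ≤-Reasoning
  ... | tri≈ _ refl _ = begin-strict
    insert r v π r       ≡⟨ insert-≡ ⟩
    v                    <⟨ after (≤-<-trans (≤-pred r≤q) (≤-pred q<c+1)) ⟩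
    π r                  ≤⟨ strictMonoOn⇒monoOn mono (≤-pred r≤q) (≤-pred q<c+1) ⟩
    π q                  ≡⟨ insert-> (≤-pred r≤q) ⟨
    insert r v π (suc q) ∎
    where open ≤-Reasoning
  insert-strictMono mono before after {suc p} {suc q} p<q q<c+1 | tri> _ _ r≤q | tri> _ _ r≤p = begin-strict
    insert r v π (suc p) ≡⟨ insert-> (≤-pred r≤p) ⟩
    π p                  <⟨ mono (≤-pred p<q) (≤-pred q<c+1) ⟩
    π q                  ≡⟨ insert-> (≤-pred r≤q) ⟨
    insert r v π (suc q) ∎
    where open ≤-Reasoning

  insert-bounded : ∀ {b} → (∀ {p} → p < c → π p < b) → v < b → ∀ {p} → p < suc c → insert r v π p < b
  insert-bounded bounded v<b {p} p<c+1 with <-cmp p r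
  ... | tri< p<r _ _  = subst (_< _) (sym (insert-< p<r)) (bounded (<-≤-trans p<r r≤c))
  ... | tri≈ _ refl _ = subst (_< _) (sym insert-≡) v<b
  insert-bounded bounded v<b {suc p} p<c+1 | tri> _ _ r≤p =
    subst (_< _) (sym (insert-> (≤-pred r≤p))) (bounded (≤-pred p<c+1))

-- Irreducible subgraphs of an irreducible block

-- A graph is a Boolean relation A on ℕ, and an induced ordered subgraph of order c is given by a
-- sequence π 0 < π 1 < … < π (c-1). A crossing at t is an edge between positions ≤ t and > t, so
-- IrreducibleOn A π c says that no pair of consecutive positions separates the edges.
module _ (A : ℕ → ℕ → Bool) where

  record Crossing (π : ℕ → ℕ) (c t : ℕ) : Set where
    constructor crossing
    field
      left right : ℕ
      left≤t     : left ≤ t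
      t<right    : t < right
      right<c    : right < c
      edge       : A (π left) (π right) ≡ true

  IrreducibleOn : (ℕ → ℕ) → ℕ → Set
  IrreducibleOn π c = ∀ {t} → suc t < c → Crossing π c t

  crossing-cong : ∀ {f g c t} → (∀ {p} → p < c → f p ≡ g p) → Crossing f c t → Crossing g c t
  crossing-cong f≗g (crossing p q p≤t t<q q<c e) =
    crossing p q p≤t t<q q<c (subst₂ (λ x y → A x y ≡ true) (f≗g (≤-<-trans p≤t (<-trans t<q q<c))) (f≗g q<c) e)

  module _ {c r v : ℕ} {π : ℕ → ℕ} where

    insert-crossing : ∀ {t t'} (w : Crossing π c t) → let open Crossing w in
                      shift r left ≤ t' → t' < shift r right → Crossing (insert r v π) (suc c) t'
    insert-crossing (crossing p q _ _ q<c e) sp≤t' t'<sq =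
      crossing (shift r p) (shift r q) sp≤t' t'<sq (≤-<-trans (shift≤suc r q) (s≤s q<c))
        (subst₂ (λ x y → A x y ≡ true) (sym (insert-shift p)) (sym (insert-shift q)) e)

    crossing-before : ∀ {t} → t < r → Crossing π c t → Crossing (insert r v π) (suc c) t
    crossing-before t<r w@(crossing p q p≤t t<q _ _) =
      insert-crossing w (≤-trans (≤-reflexive (shift-< (≤-<-trans p≤t t<r))) p≤t) (<-≤-trans t<q (≤shift r q))

    crossing-after : ∀ {t} → r ≤ suc t → Crossing π c t → Crossing (insert r v π) (suc c) (suc t)
    crossing-after r≤t+1 w@(crossing p q p≤t t<q _ _) =
      insert-crossing w (≤-trans (shift≤suc r p) (s≤s p≤t)) (<-≤-trans (s≤s t<q) (≤-reflexive (sym (shift-≥ (≤-trans r≤t+1 t<q)))))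

    insert-irreducible : IrreducibleOn π c → 0 < r →
                         (c ≤ r → Crossing (insert r v π) (suc c) (pred c)) →
                         IrreducibleOn (insert r v π) (suc c)
    insert-irreducible irr 0<r last {t} t<c with t <? r | suc t <? c
    ... | yes t<r | yes t+1<c = crossing-before t<r (irr t+1<c)
    ... | yes t<r | no  t+1≮c = subst (Crossing (insert r v π) (suc c)) (cong pred c≡t+1) (last (≤-trans (≤-reflexive c≡t+1) t<r))
      where c≡t+1 = ≤-antisym (≮⇒≥ t+1≮c) (≤-pred t<c)
    insert-irreducible irr 0<r last {zero}  t<c | no 0≮r | _ = contradiction 0<r 0≮r
    insert-irreducible irr 0<r last {suc t} t<c | no t≮r | _ = crossing-after (≮⇒≥ t≮r) (irr (≤-pred t<c))

record LongestCommonPrefix (f g : ℕ → ℕ) (m : ℕ) : Set where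
  field
    length   : ℕ
    length≤m : length ≤ m
    agree    : ∀ {p} → p < length → f p ≡ g p
    differ   : length < m → f length ≢ g length

longestCommonPrefix : ∀ f g m → LongestCommonPrefix f g m
longestCommonPrefix f g zero = record { length = 0 ; length≤m = z≤n ; agree = λ () ; differ = λ () }
longestCommonPrefix f g (suc m) with longestCommonPrefix f g m
... | record { length = r ; length≤m = r≤m ; agree = agree ; differ = differ } with m≤n⇒m<n∨m≡n r≤m | f m ≟ g m
...   | inj₁ r<m  | _ = record { length = r ; length≤m = m≤n⇒m≤1+n r≤m ; agree = agree ; differ = λ _ → differ r<m }
...   | inj₂ refl | no fr≢gr = record { length = r ; length≤m = n≤1+n r ; agree = agree ; differ = λ _ → fr≢gr }
...   | inj₂ refl | yes fr≡gr = record
  { length = suc r ; length≤m = ≤-refl ; agree = agree′ ; differ = λ r+1<r+1 → contradiction r+1<r+1 (<-irrefl refl) }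
  where
    agree′ : ∀ {p} → p < suc r → f p ≡ g p
    agree′ p<r+1 with m≤n⇒m<n∨m≡n (≤-pred p<r+1)
    ... | inj₁ p<r  = agree p<r
    ... | inj₂ refl = fr≡gr

record IrreducibleSubgraph (A : ℕ → ℕ → Bool) (a s c : ℕ) : Set where
  field
    map         : ℕ → ℕ
    map-0       : map 0 ≡ a
    strictMono  : StrictMonoOn c map
    bounded     : ∀ {p} → p < c → map p < a + s
    irreducible : IrreducibleOn A map c

  a+p≤map : ∀ {p} → p < c → a + p ≤ map p
  a+p≤map p<c = subst (λ x → x + _ ≤ map _) map-0 (strictMonoOn-stretch strictMono p<c)

module _ {A : ℕ → ℕ → Bool} {a s : ℕ} (block : IrreducibleOn A (a +_) s) where

  -- Let r be the first position at which H leaves the initial segment a, a + 1, … of the block.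
  -- If r ≤ c, inserting a + r at position r keeps every cut crossed. Otherwise H is the segment
  -- a, …, a + c, and the irreducibility of the block gives an edge from it to some a + j with
  -- j > c, which is appended.
  grow : ∀ {c} → IrreducibleSubgraph A a s (suc c) → suc c < s → IrreducibleSubgraph A a s (suc (suc c))
  grow {c} H c+1<s = growAt (longestCommonPrefix map (a +_) (suc c))
    where
      open IrreducibleSubgraph H

      insertAt : ∀ r v → 0 < r → r ≤ suc c → (map (pred r) < v) → (r < suc c → v < map r) → v < a + s →
                 (suc c ≤ r → Crossing A (insert r v map) (suc (suc c)) c) →
                 IrreducibleSubgraph A a s (suc (suc c))
      insertAt r v 0<r r≤c+1 before after v<a+s last = record
        { map         = insert r v map
        ; map-0       = trans (insert-< 0<r) map-0
        ; strictMono  = insert-strictMono r≤c+1 strictMono (λ _ → before) after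
        ; bounded     = insert-bounded r≤c+1 bounded v<a+s
        ; irreducible = insert-irreducible A irreducible 0<r last
        }

      growAt : LongestCommonPrefix map (a +_) (suc c) → IrreducibleSubgraph A a s (suc (suc c))
      growAt record { length = zero ; differ = differ } =
        contradiction (trans map-0 (sym (+-identityʳ a))) (differ (s≤s z≤n))
      growAt record { length = suc r ; length≤m = r+1≤c+1 ; agree = agree ; differ = differ }
        with m≤n⇒m<n∨m≡n (≤-pred r+1≤c+1)
      ... | inj₁ r<c = insertAt (suc r) (a + suc r) (s≤s z≤n) r+1≤c+1 below (λ _ → above) (<-trans above (bounded (s≤s r<c)))
                                (λ c+1≤r+1 → contradiction (≤-pred c+1≤r+1) (<⇒≱ r<c))
        where
          open ≤-Reasoning
          below : map r < a + suc r
          below = begin-strict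
            map r     ≡⟨ agree (n<1+n r) ⟩
            a + r     <⟨ +-monoʳ-< a (n<1+n r) ⟩
            a + suc r ∎
          above : a + suc r < map (suc r)
          above = ≤∧≢⇒< (a+p≤map (s≤s r<c)) (λ eq → differ (s≤s r<c) (sym eq))
      ... | inj₂ refl with block c+1<s
      ...   | crossing i j i≤c c<j j<s e =
        insertAt (suc c) (a + j) (s≤s z≤n) ≤-refl below (λ c+1<c+1 → contradiction c+1<c+1 (<-irrefl refl))
                 (+-monoʳ-< a j<s) last
        where
          open ≤-Reasoning
          below : map c < a + j
          below = begin-strict
            map c ≡⟨ agree (n<1+n c) ⟩
            a + c <⟨ +-monoʳ-< a c<j ⟩
            a + j ∎
          last : suc c ≤ suc c → Crossing A (insert (suc c) (a + j) map) (suc (suc c)) c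
          last _ = crossing i (suc c) i≤c (n<1+n c) ≤-refl
            (subst₂ (λ x y → A x y ≡ true) (sym (trans (insert-< (s≤s i≤c)) (agree (s≤s i≤c)))) (sym insert-≡) e)

  irreducibleSubgraph : ∀ {c} → 0 < c → c ≤ s → IrreducibleSubgraph A a s c
  irreducibleSubgraph {suc zero} _ 1≤s = record
    { map         = const a
    ; map-0       = refl
    ; strictMono  = λ { p<q (s≤s z≤n) → contradiction p<q λ () }
    ; bounded     = λ _ → m<m+n a 1≤s
    ; irreducible = λ { (s≤s ()) }
    }
  irreducibleSubgraph {suc (suc c)} _ c+2≤s = grow (irreducibleSubgraph (s≤s z≤n) (<⇒≤ c+2≤s)) c+2≤s

-- Compositions with parts in {1, …, ℓ}

splitAt-injective : ∀ m {n} {i j : Fin (m + n)} → splitAt m i ≡ splitAt m j → i ≡ j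
splitAt-injective m {n} {i} {j} eq = begin
  i                    ≡⟨ join-splitAt m n i ⟨
  join m n (splitAt m i) ≡⟨ cong (join m n) eq ⟩
  join m n (splitAt m j) ≡⟨ join-splitAt m n j ⟩
  j                    ∎
  where open ≡-Reasoning

module _ (ℓ : ℕ) where

  Part : ℕ → Set
  Part c = 1 ≤ c × c ≤ ℓ

  -- compositionFrom m n c enumerates the compositions of n + c whose first part is c + j for
  -- some j < m; there are F n ℓ + … + F (n ∸ m + 1) ℓ of them.
  compositionFrom : (m n c : ℕ) → Fin (sum (take m (Vec.toList (fibs ℓ n)))) → List ℕ
  compositionFrom zero    n       c ()
  compositionFrom (suc m) zero    c _ = c ∷ []
  compositionFrom (suc m) (suc n) c i =
    [ (c ∷_) ∘ compositionFrom ℓ n 1 , compositionFrom m n (suc c) ]′ (splitAt (F (suc n) ℓ) i)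

  composition : (n : ℕ) → Fin (F n ℓ) → List ℕ
  composition zero    _ = []
  composition (suc n) = compositionFrom ℓ n 1

  private
    c≤ℓ : ∀ {c} m → c + suc m ≤ suc ℓ → c ≤ ℓ
    c≤ℓ {c} m c+m+1≤ℓ+1 = ≤-pred (≤-trans (s≤s (m≤m+n c m)) (subst (_≤ suc ℓ) (+-suc c m) c+m+1≤ℓ+1))

  compositionFrom-parts : ∀ m n c i → 1 ≤ c → c + m ≤ suc ℓ → All Part (compositionFrom m n c i)
  compositionFrom-parts zero    n       c () _ _
  compositionFrom-parts (suc m) zero    c i 1≤c c+m+1≤ℓ+1 = (1≤c , c≤ℓ m c+m+1≤ℓ+1) ∷ []
  compositionFrom-parts (suc m) (suc n) c i 1≤c c+m+1≤ℓ+1 with splitAt (F (suc n) ℓ) i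
  ... | inj₁ x = (1≤c , c≤ℓ m c+m+1≤ℓ+1) ∷ compositionFrom-parts ℓ n 1 x ≤-refl ≤-refl
  ... | inj₂ y = compositionFrom-parts m n (suc c) y (s≤s z≤n) (subst (_≤ suc ℓ) (+-suc c m) c+m+1≤ℓ+1)

  composition-parts : ∀ n i → All Part (composition n i)
  composition-parts zero    _ = []
  composition-parts (suc n) i = compositionFrom-parts ℓ n 1 i ≤-refl ≤-refl

  compositionFrom-sum : ∀ m n c i → sum (compositionFrom m n c i) ≡ n + c
  compositionFrom-sum zero    n       c ()
  compositionFrom-sum (suc m) zero    c _ = +-identityʳ c
  compositionFrom-sum (suc m) (suc n) c i with splitAt (F (suc n) ℓ) i
  ... | inj₁ x = begin
    c + sum (compositionFrom ℓ n 1 x) ≡⟨ cong (c +_) (compositionFrom-sum ℓ n 1 x) ⟩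
    c + (n + 1)                       ≡⟨ +-comm c (n + 1) ⟩
    n + 1 + c                         ≡⟨ cong (_+ c) (+-comm n 1) ⟩
    suc n + c                         ∎
    where open ≡-Reasoning
  ... | inj₂ y = trans (compositionFrom-sum m n (suc c) y) (+-suc n c)

  composition-sum : ∀ n i → sum (composition n i) ≡ n
  composition-sum zero    _ = refl
  composition-sum (suc n) i = trans (compositionFrom-sum ℓ n 1 i) (+-comm n 1)

  compositionFrom-head : ∀ m n c i → ∃₂ λ h t → compositionFrom m n c i ≡ h ∷ t × c ≤ h
  compositionFrom-head zero    n       c ()
  compositionFrom-head (suc m) zero    c _ = c , [] , refl , ≤-refl
  compositionFrom-head (suc m) (suc n) c i with splitAt (F (suc n) ℓ) i
  ... | inj₁ x = c , compositionFrom ℓ n 1 x , refl , ≤-refl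
  ... | inj₂ y with compositionFrom-head m n (suc c) y
  ...   | h , t , eq , c<h = h , t , eq , <⇒≤ c<h

  compositionFrom-head≢ : ∀ m n c i t → c ∷ t ≢ compositionFrom m n (suc c) i
  compositionFrom-head≢ m n c i t eq with compositionFrom-head m n (suc c) i
  ... | h , _ , eq′ , c<h = <⇒≢ c<h (∷-injectiveˡ (trans eq eq′))

  compositionFrom-injective : ∀ m n c {i j} → compositionFrom m n c i ≡ compositionFrom m n c j → i ≡ j
  compositionFrom-injective (suc zero)    zero    c {Fin.zero} {Fin.zero} _ = refl
  compositionFrom-injective (suc (suc m)) zero    c {Fin.zero} {Fin.zero} _ = refl
  compositionFrom-injective (suc m)       (suc n) c {i} {j} eq
    with splitAt (F (suc n) ℓ) i in eqi | splitAt (F (suc n) ℓ) j in eqj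
  ... | inj₁ x | inj₁ x′ = splitAt-injective _ (trans eqi (trans (cong inj₁ (compositionFrom-injective ℓ n 1 (∷-injectiveʳ eq))) (sym eqj)))
  ... | inj₂ y | inj₂ y′ = splitAt-injective _ (trans eqi (trans (cong inj₂ (compositionFrom-injective m n (suc c) eq)) (sym eqj)))
  ... | inj₁ x | inj₂ y′ = contradiction eq (compositionFrom-head≢ m n c y′ _)
  ... | inj₂ y | inj₁ x′ = contradiction (sym eq) (compositionFrom-head≢ m n c y _)

  composition-injective : ∀ n {i j} → composition n i ≡ composition n j → i ≡ j
  composition-injective zero    {Fin.zero} {Fin.zero} _ = refl
  composition-injective (suc n) = compositionFrom-injective ℓ n 1

  length≤sum : ∀ {cs} → All Part cs → List.length cs ≤ sum cs
  length≤sum []                   = z≤n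
  length≤sum ((1≤c , _) ∷ parts) = +-mono-≤ 1≤c (length≤sum parts)

-- Block decompositions

-- G as a Boolean relation on ℕ, with no edges at vertices ≥ N
adjℕ : ∀ {N} → OGraph N → ℕ → ℕ → Bool
adjℕ {N} G x y with x <? N | y <? N
... | yes x<N | yes y<N = adj G (fromℕ< x<N) (fromℕ< y<N)
... | _       | _       = false

module _ {N : ℕ} (G : OGraph N) where

  adjℕ-fromℕ< : ∀ {x y} (x<N : x < N) (y<N : y < N) → adjℕ G x y ≡ adj G (fromℕ< x<N) (fromℕ< y<N)
  adjℕ-fromℕ< {x} {y} x<N y<N with x <? N | y <? N
  ... | yes _ | yes _ = refl
  ... | no x≮N | _    = contradiction x<N x≮N
  ... | yes _ | no y≮N = contradiction y<N y≮N

  adjℕ-edge : ∀ {x y} → adjℕ G x y ≡ true → ∃₂ λ i j → toℕ i ≡ x × toℕ j ≡ y × Edge G i j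
  adjℕ-edge {x} {y} e with x <? N | y <? N
  ... | yes x<N | yes y<N = fromℕ< x<N , fromℕ< y<N , toℕ-fromℕ< x<N , toℕ-fromℕ< y<N , e
  ... | no _    | _       = contradiction e λ ()
  ... | yes _   | no _    = contradiction e λ ()

  irreducible⇒irreducibleOn : ∀ a s (a+s≤N : a + s ≤ N) → Irreducible (induced G (interval a s a+s≤N)) →
                             IrreducibleOn (adjℕ G) (a +_) s
  irreducible⇒irreducibleOn a s a+s≤N irreducible {t} t+1<s
    with any? (λ i → any? (λ j → (toℕ i ≤? t) ×-dec (t <? toℕ j) ×-dec (adj (induced G (interval a s a+s≤N)) i j Bool.≟ true)))
  ... | yes (i , j , i≤t , t<j , e) =
    crossing (toℕ i) (toℕ j) i≤t t<j (toℕ<n j) (trans (adjℕ-fromℕ< (inBlock i) (inBlock j)) e)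
    where inBlock = λ (k : Fin s) → ≤-trans (+-monoʳ-< a (toℕ<n k)) a+s≤N
  ... | no ¬crossing = contradiction (u<v , separates) (irreducible u v)
    where
      u = fromℕ< (<-trans (n<1+n t) t+1<s)
      v = fromℕ< t+1<s
      u<v : u Fin.< v
      u<v = subst₂ _<_ (sym (toℕ-fromℕ< _)) (sym (toℕ-fromℕ< _)) (n<1+n t)
      separates : ∀ i j → i Fin.< j → Edge (induced G (interval a s a+s≤N)) i j → j Fin.≤ u ⊎ v Fin.≤ i
      separates i j _ e with toℕ j ≤? t | t <? toℕ i
      ... | yes j≤t | _   = inj₁ (subst (toℕ j ≤_) (sym (toℕ-fromℕ< _)) j≤t)
      ... | no _    | yes t<i = inj₂ (subst (_≤ toℕ i) (sym (toℕ-fromℕ< _)) t<i)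
      ... | no j≰t  | no t≮i = contradiction (i , j , ≮⇒≥ t≮i , ≰⇒> j≰t , e) ¬crossing

-- Chains of isolated big blocks

module _ {N : ℕ} (G : OGraph N) (ℓ : ℕ) where

  private
    A = adjℕ G

  record IsolatedBlock (a s : ℕ) : Set where
    field
      big         : ℓ ≤ s
      fits        : a + s ≤ N
      irreducible : IrreducibleOn A (a +_) s
      isolated    : ∀ {x y} → a ≤ x → x < a + s → a + s ≤ y → A x y ≡ false

  data BlockChain (lo : ℕ) : Set where
    []    : BlockChain lo
    block : ∀ {a s} → lo ≤ a → IsolatedBlock a s → BlockChain (a + s) → BlockChain lo

  length : ∀ {lo} → BlockChain lo → ℕ
  length []             = 0
  length (block _ _ ch) = suc (length ch)

  weaken : ∀ {lo lo′} → lo ≤ lo′ → BlockChain lo′ → BlockChain lo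
  weaken _      []               = []
  weaken lo≤lo′ (block lo′≤a B ch) = block (≤-trans lo≤lo′ lo′≤a) B ch

  length-weaken : ∀ {lo lo′} (lo≤lo′ : lo ≤ lo′) ch → length (weaken lo≤lo′ ch) ≡ length ch
  length-weaken _ []              = refl
  length-weaken _ (block _ _ _) = refl

  EdgesWithinBlocks : ℕ → List ℕ → Set
  EdgesWithinBlocks a ss = ∀ {x y} → a ≤ x → a ≤ y → A x y ≡ true → blockIndex ss (x ∸ a) ≡ blockIndex ss (y ∸ a)

  blockIndex-< : ∀ {s} ss {x} → x < s → blockIndex (s ∷ ss) x ≡ 0
  blockIndex-< {s} ss {x} x<s with x <ᵇ s | <⇒<ᵇ x<s
  ... | true | _ = refl

  blockIndex-≥ : ∀ {s} ss {x} → s ≤ x → blockIndex (s ∷ ss) x ≡ suc (blockIndex ss (x ∸ s))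
  blockIndex-≥ {s} ss {x} s≤x with x <ᵇ s in eq
  ... | false = refl
  ... | true  = contradiction (<ᵇ⇒< x s (subst T (sym eq) tt)) (≤⇒≯ s≤x)

  module _ {a s ss} (within : EdgesWithinBlocks a (s ∷ ss)) where

    private
      s≤x∸a : ∀ {x} → a + s ≤ x → s ≤ x ∸ a
      s≤x∸a {x} a+s≤x = m+n≤o⇒m≤o∸n s (subst (_≤ x) (+-comm a s) a+s≤x)

    edgesWithinBlocks-tail : EdgesWithinBlocks (a + s) ss
    edgesWithinBlocks-tail {x} {y} a+s≤x a+s≤y e = begin
      blockIndex ss (x ∸ (a + s))        ≡⟨ cong (blockIndex ss) (∸-+-assoc x a s) ⟨
      blockIndex ss (x ∸ a ∸ s)          ≡⟨ suc-injective (begin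
        suc (blockIndex ss (x ∸ a ∸ s))    ≡⟨ blockIndex-≥ ss (s≤x∸a a+s≤x) ⟨
        blockIndex (s ∷ ss) (x ∸ a)        ≡⟨ within (m+n≤o⇒m≤o a a+s≤x) (m+n≤o⇒m≤o a a+s≤y) e ⟩
        blockIndex (s ∷ ss) (y ∸ a)        ≡⟨ blockIndex-≥ ss (s≤x∸a a+s≤y) ⟩
        suc (blockIndex ss (y ∸ a ∸ s))    ∎) ⟩
      blockIndex ss (y ∸ a ∸ s)          ≡⟨ cong (blockIndex ss) (∸-+-assoc y a s) ⟩
      blockIndex ss (y ∸ (a + s))        ∎
      where open ≡-Reasoning

    edgesWithinBlocks-isolated : ∀ {x y} → a ≤ x → x < a + s → a + s ≤ y → A x y ≡ false
    edgesWithinBlocks-isolated {x} {y} a≤x x<a+s a+s≤y with A x y in e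
    ... | false = refl
    ... | true  = contradiction (begin
      0                           ≡⟨ blockIndex-< ss x∸a<s ⟨
      blockIndex (s ∷ ss) (x ∸ a) ≡⟨ within a≤x (m+n≤o⇒m≤o a a+s≤y) e ⟩
      blockIndex (s ∷ ss) (y ∸ a) ≡⟨ blockIndex-≥ ss (s≤x∸a a+s≤y) ⟩
      suc _                       ∎) λ ()
      where
        open ≡-Reasoning
        x∸a<s : x ∸ a < s
        x∸a<s = subst (x ∸ a <_) (m+n∸m≡n a s) (∸-monoˡ-< x<a+s a≤x)

  bigBlockChain : ∀ {a} ss → BlocksFrom G a ss → EdgesWithinBlocks a ss →
                  Σ (BlockChain a) λ ch → bigBlocks ℓ ss ≤ length ch
  bigBlockChain                 []       _                           _      = [] , z≤n
  bigBlockChain {a} (s ∷ ss) (_ , (a+s≤N , irr) , blocks) within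
    with bigBlockChain ss blocks (edgesWithinBlocks-tail {ss = ss} within) | ℓ ≤? s
  ... | ch , big≤len | yes ℓ≤s = block ≤-refl B ch ,
    subst (_≤ suc (length ch)) (sym (cong List.length (filter-accept (ℓ ≤?_) {xs = ss} ℓ≤s))) (s≤s big≤len)
    where
      B : IsolatedBlock a s
      B = record
        { big         = ℓ≤s
        ; fits        = a+s≤N
        ; irreducible = irreducible⇒irreducibleOn G a s a+s≤N irr
        ; isolated    = edgesWithinBlocks-isolated {ss = ss} within
        }
  ... | ch , big≤len | no ℓ≰s = weaken (m≤m+n a s) ch ,
    subst₂ _≤_ (sym (cong List.length (filter-reject (ℓ ≤?_) {xs = ss} ℓ≰s))) (sym (length-weaken (m≤m+n a s) ch)) big≤len

  decomposition⇒edgesWithinBlocks : ∀ {ss} → IsBlockDecomposition G ss → EdgesWithinBlocks 0 ss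
  decomposition⇒edgesWithinBlocks {ss} (_ , sameBlock) _ _ e with adjℕ-edge G e
  ... | i , j , refl , refl , eᵢⱼ = sameBlock i j eᵢⱼ

  subgraph : ∀ {a s c} → IsolatedBlock a s → Part ℓ c → IrreducibleSubgraph A a s c
  subgraph B (1≤c , c≤ℓ) = irreducibleSubgraph (IsolatedBlock.irreducible B) 1≤c (≤-trans c≤ℓ (IsolatedBlock.big B))

  -- the i-th part of cs is realised by an irreducible subgraph of the i-th block of the chain
  embed : ∀ {lo} (cs : List ℕ) → All (Part ℓ) cs → BlockChain lo → ℕ → ℕ
  embed []       _        _               = const 0
  embed (_ ∷ _)  _        []              = const 0
  embed (c ∷ cs) (p ∷ ps) (block _ B ch) = piecewise c (IrreducibleSubgraph.map (subgraph B p)) (λ x → embed cs ps ch (x ∸ c))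

  module EmbedCons {lo a s c cs} (lo≤a : lo ≤ a) (B : IsolatedBlock a s) (ch : BlockChain (a + s))
                   (p : Part ℓ c) (ps : All (Part ℓ) cs) where
    open IrreducibleSubgraph (subgraph B p) public
    open IsolatedBlock B public using (fits; isolated)

    embed-head : ∀ {x} → x < c → embed (c ∷ cs) (p ∷ ps) (block lo≤a B ch) x ≡ map x
    embed-head = piecewise-< _ _

    embed-tail : ∀ y → embed (c ∷ cs) (p ∷ ps) (block lo≤a B ch) (c + y) ≡ embed cs ps ch y
    embed-tail y = trans (piecewise-≥ _ _ (m≤m+n c y)) (cong (embed cs ps ch) (m+n∸m≡n c y))

  embed-bounds : ∀ {lo} (ch : BlockChain lo) cs ps → List.length cs ≤ length ch →
                 ∀ {x} → x < sum cs → lo ≤ embed cs ps ch x × embed cs ps ch x < N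
  embed-bounds {lo} (block {a} {s} lo≤a B ch) (c ∷ cs) (p ∷ ps) (s≤s cs≤ch) {x} x<sum with position c x
  ... | inHead x<c = subst (λ y → lo ≤ y × y < N) (sym (embed-head x<c))
                       (≤-trans lo≤a (≤-trans (m≤m+n a x) (a+p≤map x<c)) , <-≤-trans (bounded x<c) fits)
    where open EmbedCons lo≤a B ch p ps
  ... | inTail y with embed-bounds ch cs ps cs≤ch (+-cancelˡ-< c y (sum cs) x<sum)
  ...   | a+s≤e , e<N = subst (λ z → lo ≤ z × z < N) (sym (embed-tail y)) (≤-trans lo≤a (≤-trans (m≤m+n a s) a+s≤e) , e<N)
    where open EmbedCons lo≤a B ch p ps

  embed-strictMono : ∀ {lo} (ch : BlockChain lo) cs ps → List.length cs ≤ length ch → StrictMonoOn (sum cs) (embed cs ps ch)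
  embed-strictMono (block lo≤a B ch) (c ∷ cs) (p ∷ ps) (s≤s cs≤ch) {x} {y} x<y y<sum with position c y
  ... | inHead y<c = subst₂ _<_ (sym (embed-head (<-trans x<y y<c))) (sym (embed-head y<c)) (strictMono x<y y<c)
    where open EmbedCons lo≤a B ch p ps
  ... | inTail y′ with position c x
  ...   | inHead x<c = subst₂ _<_ (sym (embed-head x<c)) (sym (embed-tail y′))
                         (<-≤-trans (bounded x<c) (proj₁ (embed-bounds ch cs ps cs≤ch (+-cancelˡ-< c y′ (sum cs) y<sum))))
    where open EmbedCons lo≤a B ch p ps
  ...   | inTail x′ = subst₂ _<_ (sym (embed-tail x′)) (sym (embed-tail y′))
                        (embed-strictMono ch cs ps cs≤ch (+-cancelˡ-< c x′ y′ x<y) (+-cancelˡ-< c y′ (sum cs) y<sum))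
    where open EmbedCons lo≤a B ch p ps

  module _ {lo a s c cs} (lo≤a : lo ≤ a) (B : IsolatedBlock a s) (ch : BlockChain (a + s))
           (p : Part ℓ c) (ps : All (Part ℓ) cs) where
    open EmbedCons lo≤a B ch p ps

    embed-isolated : List.length cs ≤ length ch → ∀ {x y} → x < c → c ≤ y → y < sum (c ∷ cs) →
                     A (embed (c ∷ cs) (p ∷ ps) (block lo≤a B ch) x) (embed (c ∷ cs) (p ∷ ps) (block lo≤a B ch) y) ≡ false
    embed-isolated cs≤ch {x} {y} x<c c≤y y<sum with position c y
    ... | inHead y<c = contradiction c≤y (<⇒≱ y<c)
    ... | inTail z = subst₂ (λ u v → A u v ≡ false) (sym (embed-head x<c)) (sym (embed-tail z))
                       (isolated (≤-trans (m≤m+n a x) (a+p≤map x<c)) (bounded x<c)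
                                 (proj₁ (embed-bounds ch cs ps cs≤ch (+-cancelˡ-< c z (sum cs) y<sum))))

    embed-crossing : ∀ {t} → suc t < c → Crossing A (embed (c ∷ cs) (p ∷ ps) (block lo≤a B ch)) c t
    embed-crossing t+1<c = crossing-cong A (sym ∘ embed-head) (irreducible t+1<c)

  SameGraph : ℕ → (ℕ → ℕ) → (ℕ → ℕ) → Set
  SameGraph n f g = ∀ {x y} → x < n → y < n → A (f x) (f y) ≡ A (g x) (g y)

  sameGraph-sym : ∀ {n f g} → SameGraph n f g → SameGraph n g f
  sameGraph-sym same x<n y<n = sym (same x<n y<n)

  sameGraph-≤ : ∀ {m n f g} → m ≤ n → SameGraph n f g → SameGraph m f g
  sameGraph-≤ m≤n same x<m y<m = same (<-≤-trans x<m m≤n) (<-≤-trans y<m m≤n)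

  -- the cut after position c - 1 is crossed by an edge when the first part is d > c, but not when it is c
  firstPart-clash : ∀ {lo a s c d cs ds} (lo≤a : lo ≤ a) (B : IsolatedBlock a s) (ch : BlockChain (a + s))
                    (p : Part ℓ c) (ps : All (Part ℓ) cs) (q : Part ℓ d) (qs : All (Part ℓ) ds) →
                    List.length cs ≤ length ch → c < d → d ≤ sum (c ∷ cs) →
                    ¬ SameGraph d (embed (c ∷ cs) (p ∷ ps) (block lo≤a B ch)) (embed (d ∷ ds) (q ∷ qs) (block lo≤a B ch))
  firstPart-clash {c = suc t} lo≤a B ch p ps q qs cs≤ch c<d d≤sum same
    with embed-crossing lo≤a B ch q qs c<d
  ... | crossing x y x≤t t<y y<d e = contradiction (begin
    false           ≡⟨ embed-isolated lo≤a B ch p ps cs≤ch (s≤s x≤t) t<y (<-≤-trans y<d d≤sum) ⟨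
    A (eᶜ x) (eᶜ y) ≡⟨ same (<-trans (s≤s x≤t) c<d) y<d ⟩
    A (eᵈ x) (eᵈ y) ≡⟨ e ⟩
    true            ∎) λ ()
    where
      open ≡-Reasoning
      eᶜ = embed (suc t ∷ _) (p ∷ ps) (block lo≤a B ch)
      eᵈ = embed (_ ∷ _) (q ∷ qs) (block lo≤a B ch)

  embed-injective : ∀ {lo} (ch : BlockChain lo) cs ds ps qs → List.length cs ≤ length ch → List.length ds ≤ length ch →
                    sum cs ≡ sum ds → SameGraph (sum cs) (embed cs ps ch) (embed ds qs ch) → cs ≡ ds
  embed-injective ch [] [] _ _ _ _ _ _ = refl
  embed-injective ch [] (d ∷ ds) _ ((1≤d , _) ∷ _) _ _ sum≡ _ = contradiction sum≡ (<⇒≢ (≤-trans 1≤d (m≤m+n d (sum ds))))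
  embed-injective ch (c ∷ cs) [] ((1≤c , _) ∷ _) _ _ _ sum≡ _ = contradiction (sym sum≡) (<⇒≢ (≤-trans 1≤c (m≤m+n c (sum cs))))
  embed-injective (block lo≤a B ch) (c ∷ cs) (d ∷ ds) (p ∷ ps) (q ∷ qs) (s≤s cs≤ch) (s≤s ds≤ch) sum≡ same
    with <-cmp c d
  ... | tri< c<d _ _ = ⊥-elim (firstPart-clash lo≤a B ch p ps q qs cs≤ch c<d d≤sum (sameGraph-≤ d≤sum same))
    where d≤sum = subst (d ≤_) (sym sum≡) (m≤m+n d (sum ds))
  ... | tri> _ _ d<c = ⊥-elim (firstPart-clash lo≤a B ch q qs p ps ds≤ch d<c c≤sum (sameGraph-≤ (m≤m+n c (sum cs)) (sameGraph-sym same)))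
    where c≤sum = subst (c ≤_) sum≡ (m≤m+n c (sum cs))
  ... | tri≈ _ refl _ = cong (c ∷_) (embed-injective ch cs ds ps qs cs≤ch ds≤ch (+-cancelˡ-≡ c _ _ sum≡) same-tail)
    where
      open EmbedCons lo≤a B ch p ps using (embed-tail)
      open EmbedCons lo≤a B ch q qs using () renaming (embed-tail to embed-tail′)
      same-tail : SameGraph (sum cs) (embed cs ps ch) (embed ds qs ch)
      same-tail {x} {y} x<sum y<sum = begin
        A (embed cs ps ch x) (embed cs ps ch y) ≡⟨ cong₂ A (embed-tail x) (embed-tail y) ⟨
        A (eᶜ (c + x)) (eᶜ (c + y))             ≡⟨ same (+-monoʳ-< c x<sum) (+-monoʳ-< c y<sum) ⟩
        A (eᵈ (c + x)) (eᵈ (c + y))             ≡⟨ cong₂ A (embed-tail′ x) (embed-tail′ y) ⟩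
        A (embed ds qs ch x) (embed ds qs ch y) ∎
        where
          open ≡-Reasoning
          eᶜ = embed (c ∷ cs) (p ∷ ps) (block lo≤a B ch)
          eᵈ = embed (c ∷ ds) (q ∷ qs) (block lo≤a B ch)

  sameGraph-fromFin : ∀ {n f g} → (∀ (i j : Fin n) → A (f (toℕ i)) (f (toℕ j)) ≡ A (g (toℕ i)) (g (toℕ j))) →
                      SameGraph n f g
  sameGraph-fromFin {f = f} {g} same x<n y<n =
    subst₂ (λ x y → A (f x) (f y) ≡ A (g x) (g y)) (toℕ-fromℕ< x<n) (toℕ-fromℕ< y<n) (same (fromℕ< x<n) (fromℕ< y<n))

  toEmbedding : ∀ n (f : ℕ → ℕ) → StrictMonoOn n f → (∀ {x} → x < n → f x < N) → Embedding n N
  toEmbedding n f mono bounded = record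
    { emb  = λ i → fromℕ< (bounded (toℕ<n i))
    ; mono = λ {i} {j} i<j → subst₂ _<_ (sym (toℕ-fromℕ< (bounded (toℕ<n i)))) (sym (toℕ-fromℕ< (bounded (toℕ<n j))))
                                       (mono i<j (toℕ<n j))
    }

  adj-induced-toEmbedding : ∀ n f (mono : StrictMonoOn n f) (bounded : ∀ {x} → x < n → f x < N) (i j : Fin n) →
                            adj (induced G (toEmbedding n f mono bounded)) i j ≡ A (f (toℕ i)) (f (toℕ j))
  adj-induced-toEmbedding n f mono bounded i j = sym (adjℕ-fromℕ< G (bounded (toℕ<n i)) (bounded (toℕ<n j)))

  distinctSubgraphs : (ch : BlockChain 0) → ∀ n → n ≤ length ch → AtLeastSubgraphs n G (F n ℓ)
  distinctSubgraphs ch n n≤ch = subgraphOf , distinct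
    where
      cs = composition ℓ n
      ps = composition-parts ℓ n

      cs≤ch : ∀ i → List.length (cs i) ≤ length ch
      cs≤ch i = ≤-trans (length≤sum ℓ (ps i)) (subst (_≤ length ch) (sym (composition-sum ℓ n i)) n≤ch)

      inRange : ∀ i {x} → x < n → x < sum (cs i)
      inRange i = subst (_ <_) (sym (composition-sum ℓ n i))

      e : Fin (F n ℓ) → ℕ → ℕ
      e i = embed (cs i) (ps i) ch

      e-strictMono : ∀ i → StrictMonoOn n (e i)
      e-strictMono i x<y y<n = embed-strictMono ch (cs i) (ps i) (cs≤ch i) x<y (inRange i y<n)

      e<N : ∀ i {x} → x < n → e i x < N
      e<N i x<n = proj₂ (embed-bounds ch (cs i) (ps i) (cs≤ch i) (inRange i x<n))

      subgraphOf : Fin (F n ℓ) → Embedding n N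
      subgraphOf i = toEmbedding n (e i) (e-strictMono i) (e<N i)

      distinct : ∀ i j → OIso (induced G (subgraphOf i)) (induced G (subgraphOf j)) → i ≡ j
      distinct i j iso = composition-injective ℓ n
        (embed-injective ch (cs i) (cs j) (ps i) (ps j) (cs≤ch i) (cs≤ch j) sum≡ (subst (λ m → SameGraph m (e i) (e j)) n≡sum same))
        where
          sum≡ = trans (composition-sum ℓ n i) (sym (composition-sum ℓ n j))
          n≡sum = sym (composition-sum ℓ n i)
          same : SameGraph n (e i) (e j)
          same = sameGraph-fromFin λ x y → begin
            A (e i (toℕ x)) (e i (toℕ y))      ≡⟨ adj-induced-toEmbedding n (e i) (e-strictMono i) (e<N i) x y ⟨
            adj (induced G (subgraphOf i)) x y ≡⟨ orderIso⇒adj≡ iso x y ⟩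
            adj (induced G (subgraphOf j)) x y ≡⟨ adj-induced-toEmbedding n (e j) (e-strictMono j) (e<N j) x y ⟩
            A (e j (toℕ x)) (e j (toℕ y))      ∎
            where open ≡-Reasoning

lemma5p2 : ∀ {N} (G : OGraph N) (k ℓ : ℕ) (ss : List ℕ) →
    IsBlockDecomposition G ss → k ≤ bigBlocks ℓ ss →
    ∀ n → n ≤ k → AtLeastSubgraphs n G (F n ℓ)
lemma5p2 G k ℓ ss decomposition k≤big n n≤k
  with bigBlockChain G ℓ ss (proj₁ decomposition) (decomposition⇒edgesWithinBlocks G ℓ decomposition)
... | ch , big≤ch = distinctSubgraphs G ℓ ch n (≤-trans n≤k (≤-trans k≤big big≤ch))
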